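{- Let $m>0$, let $F=(X,R)$ be an $m$-regular cluster frame, i.e. $R^*=X\times X$ and $R^{m+1}\subseteq R$, and let $V\subseteq X$. Then there exists $U\subseteq V$ with $|U|\le m$ and $R^{ -1}[V]=R^{ -1}[U]$.
   Context: $R^*=\bigcup_{i<\omega}R^i$ is the reflexive transitive closure; $R^{ -1}[V]=\{a\in X:\exists v\in V\ aRv\}$. -}

module Defs where

open import Data.Nat using (ℕ; zero; suc; _≤_; _>_)
open import Data.Product using (Σ; ∃; _×_; _,_)
open import Data.List using (List; length)
open import Data.List.Relation.Unary.All using (All)
open import Data.List.Membership.Propositional using (_∈_)
open import Relation.Binary.PropositionalEquality using (_≡_)
open import Function.Bundles using (_⇔_)

Rel : Set → Set₁
Rel X = X → X → Set

_^[_] : {X : Set} → Rel X → ℕ → Rel X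
(R ^[ zero ]) x y = x ≡ y
(R ^[ suc n ]) x y = ∃ λ z → R x z × (R ^[ n ]) z y

_* : {X : Set} → Rel X → Rel X
(R *) x y = ∃ λ i → (R ^[ i ]) x y

IsCluster : {X : Set} → Rel X → Set
IsCluster {X} R = (x y : X) → (R *) x y

IsRegularCluster : {X : Set} → ℕ → Rel X → Set
IsRegularCluster {X} m R = IsCluster R × ((x y : X) → (R ^[ suc m ]) x y → R x y)

preimage : {X : Set} → Rel X → (X → Set) → X → Set
preimage R V a = ∃ λ v → V v × R a v

listSet : {X : Set} → List X → X → Set
listSet U x = x ∈ U

_≐_ : {X : Set} → (X → Set) → (X → Set) → Set
_≐_ {X} P Q = (x : X) → P x ⇔ Q x

{-# OPTIONS --safe #-}
module Submission where

-- Fix x₀ ∈ V. Regularity shortens a path of length 1 + n + q·m to length 1 + n, so every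
-- v ∈ V with a R v is reached from x₀ (through a, using R* = X × X) in k + 1 steps for
-- some k < m. Two targets v, w reached from x₀ in the same number of steps are
-- interchangeable: with v R^p x₀, the path from a to v, then m − 1 times around the cycle
-- v → x₀ → v, then v → x₀ → w, has length 1 + m(p + k + 1) and shortens to a single step
-- a R w. Hence one representative of V per class k < m has the same R-preimage as V;
-- excluded middle decides which classes are inhabited.

open import Defs
open import Data.Nat using (ℕ; zero; suc; _+_; _*_; _<_; _≤_; _>_; z≤n; s≤s; NonZero; >-nonZero)
open import Data.Nat.Properties using (+-identityʳ; *-comm; +-commutativeSemigroup; m<1+n⇒m<n∨m≡n; m≤n⇒m≤1+n)
open import Data.Nat.DivMod using (_%_; _/_; m≡m%n+[m/n]*n; m%n<n)
open import Algebra.Properties.CommutativeSemigroup +-commutativeSemigroup using (x∙yz≈y∙xz)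
open import Data.Product using (Σ; ∃; _×_; _,_)
open import Data.Sum using (inj₁; inj₂)
open import Data.List using (List; length; []; _∷_)
open import Data.List.Relation.Unary.All as All using (All; []; _∷_)
open import Data.List.Relation.Unary.Any using (here; there)
open import Data.List.Membership.Propositional using (_∈_)
open import Data.Empty using (⊥-elim)
open import Relation.Nullary using (yes; no)
open import Relation.Binary.PropositionalEquality using (_≡_; refl; sym; cong; subst)
open import Function.Bundles using (mk⇔)
open import Level using (0ℓ)
open import Axiom.ExcludedMiddle using (ExcludedMiddle)

module Power {X : Set} (R : Rel X) where

  ^-cast : ∀ {i j x y} → i ≡ j → (R ^[ i ]) x y → (R ^[ j ]) x y
  ^-cast {x = x} {y} = subst (λ i → (R ^[ i ]) x y)

  ^-compose : ∀ i j {x y z} → (R ^[ i ]) x y → (R ^[ j ]) y z → (R ^[ i + j ]) x z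
  ^-compose zero    j refl          q = q
  ^-compose (suc i) j (w , r , p) q = w , r , ^-compose i j p q

  ^-split : ∀ i j {x z} → (R ^[ i + j ]) x z → ∃ λ y → (R ^[ i ]) x y × (R ^[ j ]) y z
  ^-split zero    j {x} p = x , refl , p
  ^-split (suc i) j (w , r , p) with ^-split i j p
  ... | y , p₁ , p₂ = y , (w , r , p₁) , p₂

  ^-snoc : ∀ i {x y z} → (R ^[ i ]) x y → R y z → (R ^[ suc i ]) x z
  ^-snoc zero    refl        r′ = _ , r′ , refl
  ^-snoc (suc i) (w , r , p) r′ = w , r , ^-snoc i p r′

  ^-pump : ∀ {c v w} → (R ^[ c ]) v v → (R ^[ c ]) v w → ∀ j → .{{NonZero j}} → (R ^[ j * c ]) v w
  ^-pump {c} cycle path (suc zero)    = ^-cast (sym (+-identityʳ c)) path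
  ^-pump {c} cycle path (suc (suc j)) = ^-compose c (suc j * c) cycle (^-pump cycle path (suc j))

module Regular {X : Set} (R : Rel X) (m : ℕ) (regular : (x y : X) → (R ^[ suc m ]) x y → R x y) where
  open Power R

  ^-contract : ∀ q n {x y} → (R ^[ suc (n + q * m) ]) x y → (R ^[ suc n ]) x y
  ^-contract zero    n p = ^-cast (cong suc (+-identityʳ n)) p
  ^-contract (suc q) n p with ^-split (suc m) (n + q * m) (^-cast (cong suc (x∙yz≈y∙xz n m (q * m))) p)
  ... | z , p₁ , p₂ = ^-contract q n (z , regular _ z p₁ , p₂)

  ^-mod : .{{_ : NonZero m}} → ∀ q {x y} → (R ^[ suc q ]) x y → (R ^[ suc (q % m) ]) x y
  ^-mod q p = ^-contract (q / m) (q % m) (^-cast (cong suc (m≡m%n+[m/n]*n q m)) p)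

  short-path : .{{_ : NonZero m}} → IsCluster R →
               ∀ x {a v} → R a v → ∃ λ k → k < m × (R ^[ suc k ]) x v
  short-path cluster x {a} r with cluster x a
  ... | q , p = q % m , m%n<n q m , ^-mod q (^-snoc q p r)

  transfer-along-cycle : .{{_ : NonZero m}} → ∀ {c a v w} →
                         R a v → (R ^[ c ]) v v → (R ^[ c ]) v w → R a w
  transfer-along-cycle {c} {v = v} r cycle path
    with ^-contract c 0 (^-cast (cong suc (*-comm m c)) (v , r , ^-pump cycle path m))
  ... | _ , r′ , refl = r′

  transfer-same-distance : .{{_ : NonZero m}} → IsCluster R →
                           ∀ k {x a v w} → R a v → (R ^[ k ]) x v → (R ^[ k ]) x w → R a w
  transfer-same-distance cluster k {x} {v = v} r x→v x→w with cluster v x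
  ... | p , v→x = transfer-along-cycle r (^-compose p k v→x x→v) (^-compose p k v→x x→w)

representatives : ExcludedMiddle 0ℓ → {X : Set} (P : ℕ → X → Set) (j : ℕ) →
                  Σ (List X) λ U → length U ≤ j × All (λ u → ∃ λ k → P k u) U ×
                    (∀ {k} → k < j → ∃ (P k) → ∃ λ u → u ∈ U × P k u)
representatives em P zero = [] , z≤n , [] , λ ()
representatives em P (suc j) with representatives em P j | em {∃ (P j)}
... | U , |U|≤j , sound , complete | yes (u , Pju) = u ∷ U , s≤s |U|≤j , (j , Pju) ∷ sound , complete′
  where
  complete′ : ∀ {k} → k < suc j → ∃ (P k) → ∃ λ w → w ∈ u ∷ U × P k w
  complete′ k<1+j witness with m<1+n⇒m<n∨m≡n k<1+j
  ... | inj₂ refl = u , here refl , Pju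
  ... | inj₁ k<j with complete k<j witness
  ...   | w , w∈U , Pkw = w , there w∈U , Pkw
... | U , |U|≤j , sound , complete | no ∄Pj = U , m≤n⇒m≤1+n |U|≤j , sound , complete′
  where
  complete′ : ∀ {k} → k < suc j → ∃ (P k) → ∃ λ w → w ∈ U × P k w
  complete′ k<1+j witness with m<1+n⇒m<n∨m≡n k<1+j
  ... | inj₂ refl = ⊥-elim (∄Pj witness)
  ... | inj₁ k<j  = complete k<j witness

preimage-≐ : {X : Set} (R : Rel X) {V : X → Set} {U : List X} → All V U →
             (∀ {a v} → V v → R a v → ∃ λ u → u ∈ U × R a u) →
             preimage R V ≐ preimage R (listSet U)
preimage-≐ R U⊆V covers a =
  mk⇔ (λ { (v , Vv , r) → covers Vv r })
      (λ { (u , u∈U , r) → u , All.lookup U⊆V u∈U , r })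

proposition27 : ExcludedMiddle 0ℓ →
    (m : ℕ) → m > 0 →
    (X : Set) (R : Rel X) → IsRegularCluster m R →
    (V : X → Set) →
    Σ (List X) (λ U → All V U × length U ≤ m × (preimage R V ≐ preimage R (listSet U)))
proposition27 em m m>0 X R (cluster , regular) V with em {Σ X V}
... | no ∄v = [] , [] , z≤n , preimage-≐ R [] (λ {_} {v} Vv _ → ⊥-elim (∄v (v , Vv)))
... | yes (x₀ , _) with representatives em (λ k u → V u × (R ^[ suc k ]) x₀ u) m
...   | U , |U|≤m , sound , complete =
  U , U⊆V , |U|≤m , preimage-≐ R U⊆V covers
  where
  instance
    m-nonZero : NonZero m
    m-nonZero = >-nonZero m>0
  open Regular R m regular

  U⊆V : All V U
  U⊆V = All.map (λ { (_ , Vu , _) → Vu }) sound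

  covers : ∀ {a v} → V v → R a v → ∃ λ u → u ∈ U × R a u
  covers Vv r with short-path cluster x₀ r
  ... | k , k<m , x₀→v with complete k<m (_ , Vv , x₀→v)
  ...   | u , u∈U , _ , x₀→u = u , u∈U , transfer-same-distance cluster (suc k) r x₀→v x₀→u
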